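{- As formal power series in $q$ with coefficients polynomials in the free parameters $a,b,c$, \[ \sum_{i=0}^{\infty}\frac{a^iq^{T_i}}{(q;q)_i}\left(-\frac{c}{a}q;q\right)_i(-bq^{i+1};q)_\infty=\sum_{t,\ell,j\ge 0}\frac{a^tb^{\ell}c^jq^{T_{t+\ell+j}+T_j}}{(q;q)_t(q;q)_\ell(q;q)_j}. \]
   Context: $T_k=k(k+1)/2$. For $n\ge 0$, $(x;q)_n=\prod_{j=0}^{n-1}(1-xq^j)$ and $(x;q)_\infty=\prod_{j\ge0}(1-xq^j)$. Note $a^i(-\tfrac{c}{a}q;q)_i$ is a polynomial in $a,c$. -}

module Defs where

open import Level using (Level)
open import Data.Nat as ℕ using (ℕ; zero; suc; _∸_; _≡ᵇ_)
open import Data.Bool using (if_then_else_)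
open import Data.List using (List; []; _∷_)
open import Algebra.Bundles using (CommutativeRing)

tri : ℕ → ℕ
tri zero = 0
tri (suc k) = tri k ℕ.+ suc k

module Series {ℓ₁ ℓ₂ : Level} (R : CommutativeRing ℓ₁ ℓ₂) where
  open CommutativeRing R

  Ser : Set ℓ₁
  Ser = ℕ → Carrier

  sumTo : ℕ → (ℕ → Carrier) → Carrier
  sumTo zero f = 0#
  sumTo (suc n) f = sumTo n f + f n

  pow : Carrier → ℕ → Carrier
  pow x zero = 1#
  pow x (suc n) = pow x n * x

  mono : Carrier → ℕ → Ser
  mono r m n = if m ≡ᵇ n then r else 0#

  one : Ser
  one = mono 1# 0

  _⊕_ : Ser → Ser → Ser
  (f ⊕ g) n = f n + g n

  _⊛_ : Ser → Ser → Ser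
  (f ⊛ g) n = sumTo (suc n) (λ k → f k * g (n ∸ k))

  infixl 7 _⊛_
  infixl 6 _⊕_

  prodTo : ℕ → (ℕ → Ser) → Ser
  prodTo zero F = one
  prodTo (suc n) F = prodTo n F ⊛ F n

  poch : Carrier → ℕ → ℕ → Ser
  poch r s n = prodTo n (λ j → one ⊕ mono (- r) (s ℕ.+ j))

  -- (r q^s ; q)_∞ with s ≥ 1: the coefficient of q^n equals that of the
  -- finite product over the first n factors (later factors are 1 + O(q^(n+1))).
  pochInf : Carrier → ℕ → Ser
  pochInf r s n = poch r s n n

  qfac : ℕ → Ser
  qfac n = poch 1# 1 n

  -- multiplicative inverse of a series f with constant term 1:
  -- g 0 = 1, g n = - Σ_{k=1}^{n} f k * g (n-k).
  -- invRev f n = [g n, g (n-1), ..., g 0]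
  conv : Ser → ℕ → List Carrier → Carrier
  conv f k [] = 0#
  conv f k (g ∷ gs) = f k * g + conv f (suc k) gs

  invRev : Ser → ℕ → List Carrier
  invRev f zero = 1# ∷ []
  invRev f (suc n) = (- conv f 1 (invRev f n)) ∷ invRev f n

  headOr0 : List Carrier → Carrier
  headOr0 [] = 0#
  headOr0 (x ∷ _) = x

  inv : Ser → Ser
  inv f n = headOr0 (invRev f n)

  -- a^i (-(c/a) q ; q)_i = ∏_{j<i} (a + c q^(j+1))  (a polynomial in a, c)
  acPoch : Carrier → Carrier → ℕ → Ser
  acPoch a c i = prodTo i (λ j → mono a 0 ⊕ mono c (suc j))

  lhsTerm : Carrier → Carrier → Carrier → ℕ → Ser
  lhsTerm a b c i =
    mono 1# (tri i) ⊛ inv (qfac i) ⊛ acPoch a c i ⊛ pochInf (- b) (suc i)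

  rhsTerm : Carrier → Carrier → Carrier → ℕ → ℕ → ℕ → Ser
  rhsTerm a b c t l j =
    mono (pow a t * pow b l * pow c j) (tri (t ℕ.+ l ℕ.+ j) ℕ.+ tri j)
      ⊛ inv (qfac t) ⊛ inv (qfac l) ⊛ inv (qfac j)

  -- Infinite sums, coefficientwise. lhsTerm i has q-order ≥ T_i ≥ i and
  -- rhsTerm t l j has q-order ≥ T_(t+l+j) ≥ t+l+j, so only indices ≤ n
  -- contribute to the coefficient of q^n.
  LHS : Carrier → Carrier → Carrier → Ser
  LHS a b c n = sumTo (suc n) (λ i → lhsTerm a b c i n)

  RHS : Carrier → Carrier → Carrier → Ser
  RHS a b c n =
    sumTo (suc n) (λ t → sumTo (suc n) (λ l → sumTo (suc n) (λ j →
      rhsTerm a b c t l j n)))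

-- Both sides are expanded with two classical identities: the finite q-binomial theorem
--   a^i (-(c/a)q; q)_i / (q;q)_i = Σ_{t+j=i} a^t c^j q^{T_j} / ((q;q)_t (q;q)_j)
-- and Euler's expansion
--   (-b q^{i+1}; q)_∞ = Σ_ℓ b^ℓ q^{T_ℓ + iℓ} / (q;q)_ℓ.
-- Each is proved by showing that both sides satisfy the same first-order recurrence in i.
-- Multiplying out the i-th summand of the left-hand side then gives
-- Σ_{t+j=i} Σ_ℓ a^t b^ℓ c^j q^{T_{t+j} + T_j + T_ℓ + (t+j)ℓ} / ((q;q)_t (q;q)_ℓ (q;q)_j),
-- and T_{t+j} + T_ℓ + (t+j)ℓ = T_{t+ℓ+j}; summing over i removes the constraint t + j = i.

module Submission where

open import Defs
open import Data.Nat using (ℕ)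
open import Algebra.Bundles using (CommutativeRing)

open import Level using (Level)
open import Algebra.Bundles using (CommutativeMonoid)
open import Data.Bool using (true; false)
open import Data.Nat as ℕ using (zero; suc; _∸_; _≡ᵇ_; z≤n; s≤s)
import Data.Nat.Properties as ℕₚ
open import Data.Nat.Tactic.RingSolver using (solve-∀)
open import Data.Product using (_,_)
open import Data.Sum using (inj₁; inj₂)
open import Data.Empty using (⊥-elim)
open import Relation.Nullary using (Dec; yes; no)
import Relation.Binary.PropositionalEquality as ≡
open ≡ using (_≡_; _≢_)
import Relation.Binary.Reasoning.Setoid as SetoidReasoning
import Algebra.Solver.CommutativeMonoid as CommutativeMonoidSolver

n≤tri : ∀ n → n ℕ.≤ tri n
n≤tri zero    = z≤n
n≤tri (suc n) = ℕₚ.m≤n+m (suc n) (tri n)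

tri-+ : ∀ x y → tri (x ℕ.+ y) ≡ tri x ℕ.+ tri y ℕ.+ x ℕ.* y
tri-+ x zero rewrite ℕₚ.+-identityʳ x | ℕₚ.*-zeroʳ x | ℕₚ.+-identityʳ (tri x) =
  ≡.sym (ℕₚ.+-identityʳ (tri x))
tri-+ x (suc y) rewrite ℕₚ.+-suc x y | tri-+ x y = shift (tri x) (tri y) x y
  where
  shift : ∀ X Y x y → X ℕ.+ Y ℕ.+ x ℕ.* y ℕ.+ suc (x ℕ.+ y) ≡ X ℕ.+ (Y ℕ.+ suc y) ℕ.+ x ℕ.* suc y
  shift = solve-∀

exponent-merge : ∀ t l j → tri (t ℕ.+ j) ℕ.+ tri j ℕ.+ (tri l ℕ.+ (t ℕ.+ j) ℕ.* l)
                           ≡ tri (t ℕ.+ l ℕ.+ j) ℕ.+ tri j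
exponent-merge t l j rewrite tri-+ t j | tri-+ (t ℕ.+ l) j | tri-+ t l =
  regroup (tri t) (tri j) (tri l) t j l
  where
  regroup : ∀ T J L t j l → T ℕ.+ J ℕ.+ t ℕ.* j ℕ.+ J ℕ.+ (L ℕ.+ (t ℕ.+ j) ℕ.* l)
                          ≡ T ℕ.+ L ℕ.+ t ℕ.* l ℕ.+ J ℕ.+ (t ℕ.+ l) ℕ.* j ℕ.+ J
  regroup = solve-∀

module PowerSeries {ℓ₁ ℓ₂ : Level} (R : CommutativeRing ℓ₁ ℓ₂) where
  open CommutativeRing R hiding (zero)
  open Series R
  open import Algebra.Properties.Ring ring using (-‿involutive)
  open import Algebra.Properties.CommutativeSemigroup +-commutativeSemigroup
    using () renaming (interchange to +-interchange)

  module ≈-Reasoning = SetoidReasoning setoid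

  sumTo-cong : ∀ n {f g : ℕ → Carrier} → (∀ k → k ℕ.< n → f k ≈ g k) → sumTo n f ≈ sumTo n g
  sumTo-cong zero    f≈g = refl
  sumTo-cong (suc n) f≈g =
    +-cong (sumTo-cong n (λ k k<n → f≈g k (ℕₚ.m<n⇒m<1+n k<n))) (f≈g n (ℕₚ.n<1+n n))

  sumTo-cong′ : ∀ n {f g : ℕ → Carrier} → (∀ k → f k ≈ g k) → sumTo n f ≈ sumTo n g
  sumTo-cong′ n f≈g = sumTo-cong n (λ k _ → f≈g k)

  sumTo-zero : ∀ n {f : ℕ → Carrier} → (∀ k → k ℕ.< n → f k ≈ 0#) → sumTo n f ≈ 0#
  sumTo-zero zero    f≈0 = refl
  sumTo-zero (suc n) f≈0 = trans
    (+-cong (sumTo-zero n (λ k k<n → f≈0 k (ℕₚ.m<n⇒m<1+n k<n))) (f≈0 n (ℕₚ.n<1+n n)))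
    (+-identityˡ 0#)

  sumTo-distrib-+ : ∀ n {f g : ℕ → Carrier} →
                    sumTo n (λ k → f k + g k) ≈ sumTo n f + sumTo n g
  sumTo-distrib-+ zero    = sym (+-identityˡ 0#)
  sumTo-distrib-+ (suc n) = trans (+-cong (sumTo-distrib-+ n) refl) (+-interchange _ _ _ _)

  *-distribˡ-sumTo : ∀ n r {f : ℕ → Carrier} → r * sumTo n f ≈ sumTo n (λ k → r * f k)
  *-distribˡ-sumTo zero    r = zeroʳ r
  *-distribˡ-sumTo (suc n) r = trans (distribˡ r _ _) (+-cong (*-distribˡ-sumTo n r) refl)

  *-distribʳ-sumTo : ∀ n r {f : ℕ → Carrier} → sumTo n f * r ≈ sumTo n (λ k → f k * r)
  *-distribʳ-sumTo zero    r = zeroˡ r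
  *-distribʳ-sumTo (suc n) r = trans (distribʳ r _ _) (+-cong (*-distribʳ-sumTo n r) refl)

  sumTo-sucˡ : ∀ n (f : ℕ → Carrier) → sumTo (suc n) f ≈ f 0 + sumTo n (λ k → f (suc k))
  sumTo-sucˡ zero    f = trans (+-identityˡ _) (sym (+-identityʳ _))
  sumTo-sucˡ (suc n) f = trans (+-cong (sumTo-sucˡ n f) refl) (+-assoc _ _ _)

  sumTo-swap : ∀ m n (f : ℕ → ℕ → Carrier) →
               sumTo m (λ i → sumTo n (f i)) ≈ sumTo n (λ j → sumTo m (λ i → f i j))
  sumTo-swap zero    n f = sym (sumTo-zero n (λ _ _ → refl))
  sumTo-swap (suc m) n f = trans (+-cong (sumTo-swap m n f) refl) (sym (sumTo-distrib-+ n))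

  sumTo-extend : ∀ {n} N {f : ℕ → Carrier} → n ℕ.≤ N → (∀ k → n ℕ.≤ k → f k ≈ 0#) →
                 sumTo N f ≈ sumTo n f
  sumTo-extend zero z≤n _ = refl
  sumTo-extend (suc N) n≤1+N f≈0 with ℕₚ.m≤n⇒m<n∨m≡n n≤1+N
  ... | inj₂ ≡.refl = refl
  ... | inj₁ n<1+N  = let n≤N = ℕₚ.≤-pred n<1+N in
    trans (+-cong (sumTo-extend N n≤N f≈0) (f≈0 N n≤N)) (+-identityʳ _)

  sumTo-reverse : ∀ n (f : ℕ → Carrier) → sumTo (suc n) f ≈ sumTo (suc n) (λ k → f (n ∸ k))
  sumTo-reverse zero    f = refl
  sumTo-reverse (suc n) f = begin
    sumTo (suc n) f + f (suc n)                   ≈⟨ +-cong (sumTo-reverse n f) refl ⟩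
    sumTo (suc n) (λ k → f (n ∸ k)) + f (suc n)   ≈⟨ +-comm _ _ ⟩
    f (suc n) + sumTo (suc n) (λ k → f (n ∸ k))   ≈⟨ sumTo-sucˡ (suc n) (λ k → f (suc n ∸ k)) ⟨
    sumTo (suc (suc n)) (λ k → f (suc n ∸ k))     ∎
    where open ≈-Reasoning

  sumTo-triangle : ∀ N (F : ℕ → ℕ → Carrier) →
                   sumTo N (λ k → sumTo (suc k) (λ i → F i k)) ≈
                   sumTo N (λ i → sumTo (N ∸ i) (λ m → F i (i ℕ.+ m)))
  sumTo-triangle zero    F = refl
  sumTo-triangle (suc N) F = begin
    sumTo N (λ k → sumTo (suc k) (λ i → F i k)) + (sumTo N (λ i → F i N) + F N N)
      ≈⟨ +-cong (sumTo-triangle N F) refl ⟩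
    sumTo N (λ i → sumTo (N ∸ i) (λ m → F i (i ℕ.+ m))) + (sumTo N (λ i → F i N) + F N N)
      ≈⟨ +-assoc _ _ _ ⟨
    sumTo N (λ i → sumTo (N ∸ i) (λ m → F i (i ℕ.+ m))) + sumTo N (λ i → F i N) + F N N
      ≈⟨ +-cong (sym (sumTo-distrib-+ N)) diagonal ⟩
    sumTo N (λ i → sumTo (N ∸ i) (λ m → F i (i ℕ.+ m)) + F i N)
      + sumTo (suc N ∸ N) (λ m → F N (N ℕ.+ m))
      ≈⟨ +-cong (sumTo-cong N row) refl ⟩
    sumTo N (λ i → sumTo (suc N ∸ i) (λ m → F i (i ℕ.+ m)))
      + sumTo (suc N ∸ N) (λ m → F N (N ℕ.+ m)) ∎
    where
    open ≈-Reasoning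
    diagonal : F N N ≈ sumTo (suc N ∸ N) (λ m → F N (N ℕ.+ m))
    diagonal rewrite ℕₚ.m+n∸n≡m 1 N | ℕₚ.+-identityʳ N = sym (+-identityˡ _)
    row : ∀ i → i ℕ.< N → sumTo (N ∸ i) (λ m → F i (i ℕ.+ m)) + F i N
                          ≈ sumTo (suc N ∸ i) (λ m → F i (i ℕ.+ m))
    row i i<N rewrite ℕₚ.+-∸-assoc 1 (ℕₚ.<⇒≤ i<N) =
      +-cong refl (reflexive (≡.cong (F i) (≡.sym (ℕₚ.m+[n∸m]≡n (ℕₚ.<⇒≤ i<N)))))

  sumTo-antidiagonal : ∀ N (F : ℕ → ℕ → Carrier) → (∀ t j → N ℕ.≤ t ℕ.+ j → F t j ≈ 0#) →
                       sumTo N (λ i → sumTo (suc i) (λ j → F (i ∸ j) j)) ≈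
                       sumTo N (λ t → sumTo N (λ j → F t j))
  sumTo-antidiagonal N F F≈0 = begin
    sumTo N (λ i → sumTo (suc i) (λ j → F (i ∸ j) j))
      ≈⟨ sumTo-triangle N (λ j i → F (i ∸ j) j) ⟩
    sumTo N (λ j → sumTo (N ∸ j) (λ m → F (j ℕ.+ m ∸ j) j))
      ≈⟨ sumTo-cong′ N (λ j → sumTo-cong′ (N ∸ j) (λ m →
           reflexive (≡.cong (λ t → F t j) (ℕₚ.m+n∸m≡n j m)))) ⟩
    sumTo N (λ j → sumTo (N ∸ j) (λ t → F t j))
      ≈⟨ sumTo-cong′ N (λ j → sym (sumTo-extend N (ℕₚ.m∸n≤m N j)
                                   (λ t N∸j≤t → F≈0 t j (beyond N∸j≤t)))) ⟩
    sumTo N (λ j → sumTo N (λ t → F t j))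
      ≈⟨ sumTo-swap N N (λ j t → F t j) ⟩
    sumTo N (λ t → sumTo N (λ j → F t j)) ∎
    where
    open ≈-Reasoning
    beyond : ∀ {j t} → N ∸ j ℕ.≤ t → N ℕ.≤ t ℕ.+ j
    beyond {j} {t} N∸j≤t = ℕₚ.≤-trans (ℕₚ.m≤n+m∸n N j)
      (≡.subst (j ℕ.+ (N ∸ j) ℕ.≤_) (ℕₚ.+-comm j t) (ℕₚ.+-monoʳ-≤ j N∸j≤t))

  -- The ring of formal power series

  infix 4 _≋_
  _≋_ : Ser → Ser → Set ℓ₂
  f ≋ g = ∀ n → f n ≈ g n

  ≋-refl : ∀ {f} → f ≋ f
  ≋-refl n = refl

  ≋-reflexive : ∀ {f g} → f ≡ g → f ≋ g
  ≋-reflexive ≡.refl = ≋-refl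

  ≋-sym : ∀ {f g} → f ≋ g → g ≋ f
  ≋-sym f≋g n = sym (f≋g n)

  ≋-trans : ∀ {f g h} → f ≋ g → g ≋ h → f ≋ h
  ≋-trans f≋g g≋h n = trans (f≋g n) (g≋h n)

  ⊕-cong : ∀ {f f′ g g′} → f ≋ f′ → g ≋ g′ → f ⊕ g ≋ f′ ⊕ g′
  ⊕-cong f≋f′ g≋g′ n = +-cong (f≋f′ n) (g≋g′ n)

  ⊛-cong : ∀ {f f′ g g′} → f ≋ f′ → g ≋ g′ → f ⊛ g ≋ f′ ⊛ g′
  ⊛-cong f≋f′ g≋g′ n = sumTo-cong′ (suc n) (λ k → *-cong (f≋f′ k) (g≋g′ (n ∸ k)))

  ⊛-cong-≤ : ∀ f {g g′} n → (∀ m → m ℕ.≤ n → g m ≈ g′ m) → (f ⊛ g) n ≈ (f ⊛ g′) n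
  ⊛-cong-≤ f n g≈g′ = sumTo-cong (suc n) (λ k _ → *-cong refl (g≈g′ (n ∸ k) (ℕₚ.m∸n≤m n k)))

  ⊛-comm : ∀ f g → f ⊛ g ≋ g ⊛ f
  ⊛-comm f g n = trans (sumTo-reverse n _) (sumTo-cong (suc n) (λ k k≤n →
    trans (*-comm _ _) (reflexive (≡.cong (λ m → g m * f (n ∸ k)) (ℕₚ.m∸[m∸n]≡n (ℕₚ.≤-pred k≤n))))))

  ⊛-assoc : ∀ f g h → (f ⊛ g) ⊛ h ≋ f ⊛ (g ⊛ h)
  ⊛-assoc f g h n = begin
    sumTo (suc n) (λ k → sumTo (suc k) (λ i → f i * g (k ∸ i)) * h (n ∸ k))
      ≈⟨ sumTo-cong′ (suc n) (λ k → *-distribʳ-sumTo (suc k) (h (n ∸ k))) ⟩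
    sumTo (suc n) (λ k → sumTo (suc k) (λ i → f i * g (k ∸ i) * h (n ∸ k)))
      ≈⟨ sumTo-triangle (suc n) (λ i k → f i * g (k ∸ i) * h (n ∸ k)) ⟩
    sumTo (suc n) (λ i → sumTo (suc n ∸ i) (λ m → f i * g (i ℕ.+ m ∸ i) * h (n ∸ (i ℕ.+ m))))
      ≈⟨ sumTo-cong (suc n) inner ⟩
    sumTo (suc n) (λ i → f i * sumTo (suc (n ∸ i)) (λ m → g m * h (n ∸ i ∸ m))) ∎
    where
    open ≈-Reasoning
    inner : ∀ i → i ℕ.< suc n →
            sumTo (suc n ∸ i) (λ m → f i * g (i ℕ.+ m ∸ i) * h (n ∸ (i ℕ.+ m)))
            ≈ f i * sumTo (suc (n ∸ i)) (λ m → g m * h (n ∸ i ∸ m))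
    inner i i≤n rewrite ℕₚ.+-∸-assoc 1 (ℕₚ.≤-pred i≤n) = trans
      (sumTo-cong′ (suc (n ∸ i)) (λ m → trans (*-assoc _ _ _) (*-cong refl (*-cong
        (reflexive (≡.cong g (ℕₚ.m+n∸m≡n i m)))
        (reflexive (≡.cong h (≡.sym (ℕₚ.∸-+-assoc n i m))))))))
      (sym (*-distribˡ-sumTo (suc (n ∸ i)) (f i)))

  ⊛-identityˡ : ∀ f → one ⊛ f ≋ f
  ⊛-identityˡ f n = begin
    sumTo (suc n) (λ k → one k * f (n ∸ k))        ≈⟨ sumTo-sucˡ n _ ⟩
    1# * f n + sumTo n (λ k → 0# * f (n ∸ suc k))  ≈⟨ +-cong (*-identityˡ _) (sumTo-zero n (λ k _ → zeroˡ _)) ⟩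
    f n + 0#                                        ≈⟨ +-identityʳ _ ⟩
    f n                                             ∎
    where open ≈-Reasoning

  ⊛-identityʳ : ∀ f → f ⊛ one ≋ f
  ⊛-identityʳ f = ≋-trans (⊛-comm f one) (⊛-identityˡ f)

  ⊛-distribˡ : ∀ f g h → f ⊛ (g ⊕ h) ≋ f ⊛ g ⊕ f ⊛ h
  ⊛-distribˡ f g h n = trans (sumTo-cong′ (suc n) (λ k → distribˡ _ _ _)) (sumTo-distrib-+ (suc n))

  ⊛-distribʳ : ∀ f g h → (g ⊕ h) ⊛ f ≋ g ⊛ f ⊕ h ⊛ f
  ⊛-distribʳ f g h n = trans (sumTo-cong′ (suc n) (λ k → distribʳ _ _ _)) (sumTo-distrib-+ (suc n))

  ⊛-coeff₀ : ∀ f g → (f ⊛ g) 0 ≈ f 0 * g 0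
  ⊛-coeff₀ f g = +-identityˡ _

  ⊛-commutativeMonoid : CommutativeMonoid ℓ₁ ℓ₂
  ⊛-commutativeMonoid = record
    { Carrier = Ser ; _≈_ = _≋_ ; _∙_ = _⊛_ ; ε = one
    ; isCommutativeMonoid = record
      { isMonoid = record
        { isSemigroup = record
          { isMagma = record
            { isEquivalence = record { refl = ≋-refl ; sym = ≋-sym ; trans = ≋-trans }
            ; ∙-cong = ⊛-cong }
          ; assoc = ⊛-assoc }
        ; identity = ⊛-identityˡ , ⊛-identityʳ }
      ; comm = ⊛-comm } }

  module ≋-Reasoning = SetoidReasoning (CommutativeMonoid.setoid ⊛-commutativeMonoid)
  open CommutativeMonoidSolver ⊛-commutativeMonoid using (solve; _⊜_) renaming (_⊕_ to _⊙_)

  mono-at : ∀ r m → mono r m m ≡ r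
  mono-at r m with m ≡ᵇ m | ℕₚ.≡⇒≡ᵇ m m ≡.refl
  ... | true | _ = ≡.refl

  mono-off : ∀ r {m n} → m ≢ n → mono r m n ≡ 0#
  mono-off r {m} {n} m≢n with m ≡ᵇ n | ℕₚ.≡ᵇ⇒≡ m n
  ... | true  | m≡n = ⊥-elim (m≢n (m≡n _))
  ... | false | _   = ≡.refl

  mono-congˡ : ∀ {r s} m → r ≈ s → mono r m ≋ mono s m
  mono-congˡ m r≈s n with m ≡ᵇ n
  ... | true  = r≈s
  ... | false = refl

  mono-inverseˡ : ∀ r m → mono (- r) m ⊕ mono r m ≋ (λ _ → 0#)
  mono-inverseˡ r m n with m ≡ᵇ n
  ... | true  = -‿inverseˡ r
  ... | false = +-identityʳ 0#

  sumTo-sift-outside : ∀ N r m (g : ℕ → Carrier) → N ℕ.≤ m → sumTo N (λ k → mono r m k * g k) ≈ 0#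
  sumTo-sift-outside N r m g N≤m = sumTo-zero N (λ k k<N →
    trans (*-cong (reflexive (mono-off r (λ m≡k → ℕₚ.<-irrefl (≡.sym m≡k) (ℕₚ.<-≤-trans k<N N≤m)))) refl)
          (zeroˡ _))

  sumTo-sift : ∀ N r m (g : ℕ → Carrier) → m ℕ.< N → sumTo N (λ k → mono r m k * g k) ≈ r * g m
  sumTo-sift (suc N) r m g m<1+N with ℕₚ.m≤n⇒m<n∨m≡n (ℕₚ.≤-pred m<1+N)
  ... | inj₁ m<N = trans
    (+-cong (sumTo-sift N r m g m<N)
            (trans (*-cong (reflexive (mono-off r (λ m≡N → ℕₚ.<-irrefl m≡N m<N))) refl) (zeroˡ _)))
    (+-identityʳ _)
  ... | inj₂ ≡.refl = trans
    (+-cong (sumTo-sift-outside m r m g ℕₚ.≤-refl) (*-cong (reflexive (mono-at r m)) refl))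
    (+-identityˡ _)

  mono⊛-≤ : ∀ r m f n → m ℕ.≤ n → (mono r m ⊛ f) n ≈ r * f (n ∸ m)
  mono⊛-≤ r m f n m≤n = sumTo-sift (suc n) r m (λ k → f (n ∸ k)) (s≤s m≤n)

  mono⊛-< : ∀ r m f n → n ℕ.< m → (mono r m ⊛ f) n ≈ 0#
  mono⊛-< r m f n n<m = sumTo-sift-outside (suc n) r m (λ k → f (n ∸ k)) n<m

  mono⊛mono : ∀ r s m k → mono r m ⊛ mono s k ≋ mono (r * s) (m ℕ.+ k)
  mono⊛mono r s m k n with m ℕ.≤? n
  ... | no m≰n = trans (mono⊛-< r m (mono s k) n (ℕₚ.≰⇒> m≰n)) (sym (reflexive
    (mono-off (r * s) (λ m+k≡n → m≰n (≡.subst (m ℕ.≤_) m+k≡n (ℕₚ.m≤m+n m k))))))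
  ... | yes m≤n = trans (mono⊛-≤ r m (mono s k) n m≤n) (shifted (k ℕ.≟ n ∸ m))
    where
    shifted : Dec (k ≡ n ∸ m) → r * mono s k (n ∸ m) ≈ mono (r * s) (m ℕ.+ k) n
    shifted (yes ≡.refl) rewrite mono-at s (n ∸ m) | ℕₚ.m+[n∸m]≡n m≤n | mono-at (r * s) n = refl
    shifted (no k≢n∸m) rewrite mono-off s k≢n∸m
      | mono-off (r * s) {m ℕ.+ k} {n}
          (λ m+k≡n → k≢n∸m (≡.trans (≡.sym (ℕₚ.m+n∸m≡n m k)) (≡.cong (_∸ m) m+k≡n)))
      = zeroʳ r

  Order≥ : Ser → ℕ → Set ℓ₂
  Order≥ f k = ∀ n → n ℕ.< k → f n ≈ 0#

  order-≤ : ∀ {f j k} → j ℕ.≤ k → Order≥ f k → Order≥ f j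
  order-≤ j≤k f=O n n<j = f=O n (ℕₚ.<-≤-trans n<j j≤k)

  order-⊛ˡ : ∀ {f} g {k} → Order≥ f k → Order≥ (f ⊛ g) k
  order-⊛ˡ g f=O n n<k = sumTo-zero (suc n) (λ i i≤n →
    trans (*-cong (f=O i (ℕₚ.≤-<-trans (ℕₚ.≤-pred i≤n) n<k)) refl) (zeroˡ _))

  order-mono : ∀ r m → Order≥ (mono r m) m
  order-mono r m n n<m = reflexive (mono-off r (λ m≡n → ℕₚ.<-irrefl (≡.sym m≡n) n<m))

  order-mono⊛ : ∀ r m {X k} → Order≥ X k → Order≥ (mono r m ⊛ X) (m ℕ.+ k)
  order-mono⊛ r m {X} {k} X=O n n<m+k with m ℕ.≤? n
  ... | no m≰n  = mono⊛-< r m X n (ℕₚ.≰⇒> m≰n)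
  ... | yes m≤n = trans (mono⊛-≤ r m X n m≤n) (trans (*-cong refl (X=O (n ∸ m) n∸m<k)) (zeroʳ r))
    where
    n∸m<k : n ∸ m ℕ.< k
    n∸m<k = ℕₚ.+-cancelˡ-< m (n ∸ m) k (≡.subst (ℕ._< m ℕ.+ k) (≡.sym (ℕₚ.m+[n∸m]≡n m≤n)) n<m+k)

  sumSer : ℕ → (ℕ → Ser) → Ser
  sumSer N F n = sumTo N (λ i → F i n)

  sumSer-cong : ∀ N {F G : ℕ → Ser} → (∀ i → i ℕ.< N → F i ≋ G i) → sumSer N F ≋ sumSer N G
  sumSer-cong N F≋G n = sumTo-cong N (λ i i<N → F≋G i i<N n)

  sumSer-distrib-⊕ : ∀ N {F G : ℕ → Ser} → sumSer N (λ i → F i ⊕ G i) ≋ sumSer N F ⊕ sumSer N G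
  sumSer-distrib-⊕ N n = sumTo-distrib-+ N

  ⊛-sumSer : ∀ g N F → g ⊛ sumSer N F ≋ sumSer N (λ i → g ⊛ F i)
  ⊛-sumSer g N F n = trans (sumTo-cong′ (suc n) (λ k → *-distribˡ-sumTo N (g k))) (sumTo-swap (suc n) N _)

  sumSer-⊛ : ∀ g N F → sumSer N F ⊛ g ≋ sumSer N (λ i → F i ⊛ g)
  sumSer-⊛ g N F = ≋-trans (⊛-comm (sumSer N F) g)
    (≋-trans (⊛-sumSer g N F) (sumSer-cong N (λ i _ → ⊛-comm g (F i))))

  -- For summable F only the terms i ≤ n contribute to the coefficient of q^n, which is all sum∞ adds up.
  Summable : (ℕ → Ser) → Set ℓ₂
  Summable F = ∀ i → Order≥ (F i) i

  sum∞ : (ℕ → Ser) → Ser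
  sum∞ F n = sumTo (suc n) (λ i → F i n)

  sum∞-cong : ∀ {F G} → (∀ i → F i ≋ G i) → sum∞ F ≋ sum∞ G
  sum∞-cong F≋G n = sumTo-cong′ (suc n) (λ i → F≋G i n)

  sum∞-truncate : ∀ {F} → Summable F → ∀ {n N} → suc n ℕ.≤ N → sumTo N (λ i → F i n) ≈ sum∞ F n
  sum∞-truncate F-summable {n} {N} n<N = sumTo-extend N n<N (λ i n<i → F-summable i n n<i)

  ⊛-sum∞ : ∀ g {F} → Summable F → g ⊛ sum∞ F ≋ sum∞ (λ i → g ⊛ F i)
  ⊛-sum∞ g {F} F-summable n = begin
    sumTo (suc n) (λ k → g k * sum∞ F (n ∸ k))
      ≈⟨ sumTo-cong′ (suc n) (λ k → *-cong refl (sym (sum∞-truncate F-summable (s≤s (ℕₚ.m∸n≤m n k))))) ⟩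
    sumTo (suc n) (λ k → g k * sumTo (suc n) (λ i → F i (n ∸ k)))
      ≈⟨ ⊛-sumSer g (suc n) F n ⟩
    sum∞ (λ i → g ⊛ F i) n ∎
    where open ≈-Reasoning

  -- Inverses of series with constant term 1

  module _ (f : Ser) where

    conv-invRev : ∀ n k → conv f k (invRev f n) ≈ sumTo (suc n) (λ m → f (k ℕ.+ m) * inv f (n ∸ m))
    conv-invRev zero k rewrite ℕₚ.+-identityʳ k = trans (+-identityʳ _) (sym (+-identityˡ _))
    conv-invRev (suc n) k = begin
      f k * inv f (suc n) + conv f (suc k) (invRev f n)
        ≈⟨ +-cong (*-cong (reflexive (≡.cong f (≡.sym (ℕₚ.+-identityʳ k)))) refl) (conv-invRev n (suc k)) ⟩
      f (k ℕ.+ 0) * inv f (suc n) + sumTo (suc n) (λ m → f (suc k ℕ.+ m) * inv f (n ∸ m))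
        ≈⟨ +-cong refl (sumTo-cong′ (suc n) (λ m → *-cong (reflexive (≡.cong f (≡.sym (ℕₚ.+-suc k m)))) refl)) ⟩
      f (k ℕ.+ 0) * inv f (suc n) + sumTo (suc n) (λ m → f (k ℕ.+ suc m) * inv f (n ∸ m))
        ≈⟨ sumTo-sucˡ (suc n) _ ⟨
      sumTo (suc (suc n)) (λ m → f (k ℕ.+ m) * inv f (suc n ∸ m)) ∎
      where open ≈-Reasoning

    ⊛-inverseʳ : f 0 ≈ 1# → f ⊛ inv f ≋ one
    ⊛-inverseʳ f₀≈1 zero    = trans (+-identityˡ _) (trans (*-cong f₀≈1 refl) (*-identityˡ _))
    ⊛-inverseʳ f₀≈1 (suc n) = begin
      sumTo (suc (suc n)) (λ k → f k * inv f (suc n ∸ k))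
        ≈⟨ sumTo-sucˡ (suc n) _ ⟩
      f 0 * inv f (suc n) + sumTo (suc n) (λ k → f (suc k) * inv f (n ∸ k))
        ≈⟨ +-cong (trans (*-cong f₀≈1 refl) (*-identityˡ _)) (sym (conv-invRev n 1)) ⟩
      - conv f 1 (invRev f n) + conv f 1 (invRev f n)
        ≈⟨ -‿inverseˡ _ ⟩
      0# ∎
      where open ≈-Reasoning

    ⊛-cancelʳ : ∀ {X Y} → f 0 ≈ 1# → X ⊛ f ≋ Y ⊛ f → X ≋ Y
    ⊛-cancelʳ {X} {Y} f₀≈1 Xf≋Yf = begin
      X                 ≈⟨ ⊛-identityʳ X ⟨
      X ⊛ one           ≈⟨ ⊛-cong (≋-refl {X}) (⊛-inverseʳ f₀≈1) ⟨
      X ⊛ (f ⊛ inv f)   ≈⟨ ⊛-assoc X f (inv f) ⟨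
      X ⊛ f ⊛ inv f     ≈⟨ ⊛-cong Xf≋Yf (≋-refl {inv f}) ⟩
      Y ⊛ f ⊛ inv f     ≈⟨ ⊛-assoc Y f (inv f) ⟩
      Y ⊛ (f ⊛ inv f)   ≈⟨ ⊛-cong (≋-refl {Y}) (⊛-inverseʳ f₀≈1) ⟩
      Y ⊛ one           ≈⟨ ⊛-identityʳ Y ⟩
      Y                 ∎
      where open ≋-Reasoning

  inv-one : inv one ≋ one
  inv-one = ≋-trans (≋-sym (⊛-identityˡ (inv one))) (⊛-inverseʳ one refl)

  1-q^_ : ℕ → Ser
  1-q^ m = one ⊕ mono (- 1#) m

  1-q^0≈0 : ∀ n → (1-q^ 0) n ≈ 0#
  1-q^0≈0 zero    = -‿inverseʳ 1#
  1-q^0≈0 (suc n) = +-identityʳ 0#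

  ⊛-1-q^0 : ∀ f n → (f ⊛ 1-q^ 0) n ≈ 0#
  ⊛-1-q^0 f n = sumTo-zero (suc n) (λ k _ → trans (*-cong refl (1-q^0≈0 (n ∸ k))) (zeroʳ _))

  q^⊕1-q^ : ∀ m → mono 1# m ⊕ 1-q^ m ≋ one
  q^⊕1-q^ m n = trans (+-comm _ _) (trans (+-assoc _ _ _)
    (trans (+-cong refl (mono-inverseˡ 1# m n)) (+-identityʳ _)))

  1-q^-+ : ∀ t j → 1-q^ (t ℕ.+ j) ≋ 1-q^ t ⊕ mono 1# t ⊛ 1-q^ j
  1-q^-+ t j n = sym (begin
    (one n + mono (- 1#) t n) + (mono 1# t ⊛ 1-q^ j) n
      ≈⟨ +-cong refl q^t[1-q^j] ⟩
    (one n + mono (- 1#) t n) + (mono 1# t n + mono (- 1#) (t ℕ.+ j) n)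
      ≈⟨ +-interchange _ _ _ _ ⟩
    (one n + mono 1# t n) + (mono (- 1#) t n + mono (- 1#) (t ℕ.+ j) n)
      ≈⟨ +-assoc _ _ _ ⟩
    one n + (mono 1# t n + (mono (- 1#) t n + mono (- 1#) (t ℕ.+ j) n))
      ≈⟨ +-cong refl (trans (sym (+-assoc _ _ _)) (+-cong (trans (+-comm _ _) (mono-inverseˡ 1# t n)) refl)) ⟩
    one n + (0# + mono (- 1#) (t ℕ.+ j) n)
      ≈⟨ +-cong refl (+-identityˡ _) ⟩
    one n + mono (- 1#) (t ℕ.+ j) n ∎)
    where
    open ≈-Reasoning
    q^t[1-q^j] : (mono 1# t ⊛ 1-q^ j) n ≈ mono 1# t n + mono (- 1#) (t ℕ.+ j) n
    q^t[1-q^j] = trans (⊛-distribˡ (mono 1# t) one (mono (- 1#) j) n)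
      (+-cong (⊛-identityʳ (mono 1# t) n)
              (trans (mono⊛mono 1# (- 1#) t j n) (mono-congˡ (t ℕ.+ j) (*-identityˡ _) n)))

  one⊕mono-⊛ : ∀ X r k n → ((one ⊕ mono r k) ⊛ X) n ≈ X n + (mono r k ⊛ X) n
  one⊕mono-⊛ X r k n = trans (⊛-distribʳ X one (mono r k) n) (+-cong (⊛-identityˡ X n) refl)

  ⊛-one⊕mono-< : ∀ X r {k} m → m ℕ.< k → (X ⊛ (one ⊕ mono r k)) m ≈ X m
  ⊛-one⊕mono-< X r {k} m m<k = trans (⊛-distribˡ X one (mono r k) m)
    (trans (+-cong (⊛-identityʳ X m) (trans (⊛-comm X (mono r k) m) (mono⊛-< r k X m m<k)))
           (+-identityʳ _))

  prodTo-cong : ∀ {F G : ℕ → Ser} n → (∀ j → F j ≋ G j) → prodTo n F ≋ prodTo n G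
  prodTo-cong zero    F≋G = ≋-refl
  prodTo-cong (suc n) F≋G = ⊛-cong (prodTo-cong n F≋G) (F≋G n)

  prodTo-sucˡ : ∀ (F : ℕ → Ser) n → prodTo (suc n) F ≋ F 0 ⊛ prodTo n (λ j → F (suc j))
  prodTo-sucˡ F zero    = ≋-trans (⊛-identityˡ (F 0)) (≋-sym (⊛-identityʳ (F 0)))
  prodTo-sucˡ F (suc n) = ≋-trans (⊛-cong (prodTo-sucˡ F n) (≋-refl {F (suc n)}))
                                  (⊛-assoc (F 0) (prodTo n (λ j → F (suc j))) (F (suc n)))

  prodTo-coeff₀ : ∀ (F : ℕ → Ser) → (∀ j → F j 0 ≈ 1#) → ∀ n → prodTo n F 0 ≈ 1#
  prodTo-coeff₀ F F₀≈1 zero    = refl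
  prodTo-coeff₀ F F₀≈1 (suc n) =
    trans (⊛-coeff₀ (prodTo n F) (F n)) (trans (*-cong (prodTo-coeff₀ F F₀≈1 n) (F₀≈1 n)) (*-identityˡ _))

  qfac-inverseʳ : ∀ t → qfac t ⊛ inv (qfac t) ≋ one
  qfac-inverseʳ t = ⊛-inverseʳ (qfac t) (prodTo-coeff₀ _ (λ _ → +-identityʳ 1#) t)

  inv-qfac-suc : ∀ t → inv (qfac (suc t)) ⊛ 1-q^ (suc t) ≋ inv (qfac t)
  inv-qfac-suc t = begin
    I′ ⊛ 1-q^ (suc t)                  ≈⟨ ⊛-identityʳ _ ⟨
    I′ ⊛ 1-q^ (suc t) ⊛ one            ≈⟨ ⊛-cong (≋-refl {I′ ⊛ 1-q^ (suc t)}) (qfac-inverseʳ t) ⟨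
    I′ ⊛ 1-q^ (suc t) ⊛ (qfac t ⊛ I)
      ≈⟨ solve 4 (λ i′ d q i → (i′ ⊙ d) ⊙ (q ⊙ i) ⊜ (i′ ⊙ (q ⊙ d)) ⊙ i)
               ≋-refl I′ (1-q^ (suc t)) (qfac t) I ⟩
    I′ ⊛ qfac (suc t) ⊛ I
      ≈⟨ ⊛-cong (≋-trans (⊛-comm I′ (qfac (suc t))) (qfac-inverseʳ (suc t))) (≋-refl {I}) ⟩
    one ⊛ I                            ≈⟨ ⊛-identityˡ I ⟩
    I                                  ∎
    where
    open ≋-Reasoning
    I′ I : Ser
    I′ = inv (qfac (suc t))
    I = inv (qfac t)

  -- Every factor beyond the M-th is 1 - r q^(s+j) with j ≥ M, hence ≡ 1 mod q^(s+M).
  poch-stable : ∀ r s {M} N m → m ℕ.< s ℕ.+ M → M ℕ.≤ N → poch r s N m ≈ poch r s M m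
  poch-stable r s zero    m _ z≤n = refl
  poch-stable r s (suc N) m m<s+M M≤1+N with ℕₚ.m≤n⇒m<n∨m≡n M≤1+N
  ... | inj₂ ≡.refl = refl
  ... | inj₁ M<1+N  = let M≤N = ℕₚ.≤-pred M<1+N in
    trans (⊛-one⊕mono-< (poch r s N) (- r) m (ℕₚ.<-≤-trans m<s+M (ℕₚ.+-monoʳ-≤ s M≤N)))
          (poch-stable r s N m m<s+M M≤N)

  pochInf-truncate : ∀ r s {M} m → m ℕ.< suc s ℕ.+ M → poch r (suc s) M m ≈ pochInf r (suc s) m
  pochInf-truncate r s {M} m m<1+s+M with ℕₚ.≤-total M m
  ... | inj₁ M≤m = sym (poch-stable r (suc s) m m m<1+s+M M≤m)
  ... | inj₂ m≤M = poch-stable r (suc s) M m (s≤s (ℕₚ.m≤n+m m s)) m≤M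

  pochInf-low : ∀ r s n → n ℕ.< suc s → pochInf r (suc s) n ≈ one n
  pochInf-low r s n n≤s =
    sym (pochInf-truncate r s {0} n (≡.subst (n ℕ.<_) (≡.sym (ℕₚ.+-identityʳ (suc s))) n≤s))

  pochInf-unfold : ∀ r s → pochInf r (suc s) ≋ (one ⊕ mono (- r) (suc s)) ⊛ pochInf r (suc (suc s))
  pochInf-unfold r s zero =
    sym (trans (+-identityˡ _) (trans (*-cong (+-identityʳ 1#) refl) (*-identityˡ 1#)))
  pochInf-unfold r s (suc n) = begin
    prodTo (suc n) F (suc n)
      ≈⟨ prodTo-sucˡ F n (suc n) ⟩
    (F 0 ⊛ prodTo n (λ j → F (suc j))) (suc n)
      ≈⟨ ⊛-cong (⊕-cong ≋-refl (≋-reflexive (≡.cong (mono (- r)) (ℕₚ.+-identityʳ (suc s)))))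
                (prodTo-cong n (λ j → ⊕-cong ≋-refl (≋-reflexive (≡.cong (mono (- r)) (ℕₚ.+-suc (suc s) j)))))
                (suc n) ⟩
    ((one ⊕ mono (- r) (suc s)) ⊛ X) (suc n)
      ≈⟨ one⊕mono-⊛ X (- r) (suc s) (suc n) ⟩
    X (suc n) + (mono (- r) (suc s) ⊛ X) (suc n)
      ≈⟨ +-cong (pochInf-truncate r (suc s) (suc n) (s≤s (s≤s (ℕₚ.m≤n+m n s))))
                (⊛-cong-≤ (mono (- r) (suc s)) (suc n) (λ m m≤1+n →
                  pochInf-truncate r (suc s) m (ℕₚ.≤-<-trans m≤1+n (s≤s (s≤s (ℕₚ.m≤n+m n s)))))) ⟩
    E (suc n) + (mono (- r) (suc s) ⊛ E) (suc n)
      ≈⟨ one⊕mono-⊛ E (- r) (suc s) (suc n) ⟨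
    ((one ⊕ mono (- r) (suc s)) ⊛ E) (suc n) ∎
    where
    open ≈-Reasoning
    F : ℕ → Ser
    F j = one ⊕ mono (- r) (suc s ℕ.+ j)
    X E : Ser
    X = poch r (suc (suc s)) n
    E = pochInf r (suc (suc s))

  -- The coefficient of q^n in K i ⊛ E (i+1) involves E (i+1) only up to q^n, so agreement
  -- below q^(i+1) for every i propagates to all orders.
  recurrence-unique : ∀ (K : ℕ → Ser) {E G : ℕ → Ser} →
                      (∀ i → E i ≋ K i ⊛ E (suc i)) → (∀ i → G i ≋ K i ⊛ G (suc i)) →
                      (∀ i n → n ℕ.< suc i → E i n ≈ G i n) → ∀ i → E i ≋ G i
  recurrence-unique K {E} {G} E-rec G-rec low i n = agree n i n (ℕₚ.m<n+m n (s≤s z≤n))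
    where
    agree : ∀ k i n → n ℕ.< suc i ℕ.+ k → E i n ≈ G i n
    agree zero    i n n<1+i+0 = low i n (≡.subst (n ℕ.<_) (ℕₚ.+-identityʳ (suc i)) n<1+i+0)
    agree (suc k) i n n<1+i+1+k = begin
      E i n                  ≈⟨ E-rec i n ⟩
      (K i ⊛ E (suc i)) n
        ≈⟨ ⊛-cong-≤ (K i) n (λ m m≤n → agree k (suc i) m (ℕₚ.≤-<-trans m≤n n<2+i+k)) ⟩
      (K i ⊛ G (suc i)) n    ≈⟨ G-rec i n ⟨
      G i n                  ∎
      where
      open ≈-Reasoning
      n<2+i+k : n ℕ.< suc (suc i) ℕ.+ k
      n<2+i+k = ≡.subst (n ℕ.<_) (ℕₚ.+-suc (suc i) k) n<1+i+1+k

  -- The finite q-binomial theorem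

  module QBinomial (a c : Carrier) where

    binomialTerm : ℕ → ℕ → Ser
    binomialTerm t j = mono (pow a t * pow c j) (tri j) ⊛ inv (qfac t) ⊛ inv (qfac j)

    binomialSum : ℕ → Ser
    binomialSum i = sumSer (suc i) (λ j → binomialTerm (i ∸ j) j)

    acFactor : ℕ → Ser
    acFactor i = mono a 0 ⊕ mono c (suc i)

    acRatio : ℕ → Ser
    acRatio i = acPoch a c i ⊛ inv (qfac i)

    binomialTerm-sucˡ : ∀ t j → binomialTerm (suc t) j ⊛ 1-q^ (suc t) ≋ mono a 0 ⊛ binomialTerm t j
    binomialTerm-sucˡ t j = begin
      M′ ⊛ I′ ⊛ J ⊛ 1-q^ (suc t)
        ≈⟨ solve 4 (λ m i′ j d → ((m ⊙ i′) ⊙ j) ⊙ d ⊜ (m ⊙ (i′ ⊙ d)) ⊙ j)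
                 ≋-refl M′ I′ J (1-q^ (suc t)) ⟩
      M′ ⊛ (I′ ⊛ 1-q^ (suc t)) ⊛ J
        ≈⟨ ⊛-cong (⊛-cong (≋-sym a·M) (inv-qfac-suc t)) (≋-refl {J}) ⟩
      mono a 0 ⊛ M ⊛ I ⊛ J
        ≈⟨ solve 4 (λ x m i j → ((x ⊙ m) ⊙ i) ⊙ j ⊜ x ⊙ ((m ⊙ i) ⊙ j)) ≋-refl (mono a 0) M I J ⟩
      mono a 0 ⊛ binomialTerm t j ∎
      where
      open ≋-Reasoning
      M M′ I I′ J : Ser
      M = mono (pow a t * pow c j) (tri j)
      M′ = mono (pow a (suc t) * pow c j) (tri j)
      I = inv (qfac t)
      I′ = inv (qfac (suc t))
      J = inv (qfac j)
      a·M : mono a 0 ⊛ M ≋ M′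
      a·M = ≋-trans (mono⊛mono a _ 0 (tri j))
                    (mono-congˡ (tri j) (trans (sym (*-assoc _ _ _)) (*-cong (*-comm _ _) refl)))

    binomialTerm-sucʳ : ∀ t j → binomialTerm t (suc j) ⊛ (mono 1# t ⊛ 1-q^ (suc j))
                                ≋ mono c (suc (t ℕ.+ j)) ⊛ binomialTerm t j
    binomialTerm-sucʳ t j = begin
      M′ ⊛ I ⊛ J′ ⊛ (mono 1# t ⊛ 1-q^ (suc j))
        ≈⟨ solve 5 (λ m i j′ x d → ((m ⊙ i) ⊙ j′) ⊙ (x ⊙ d) ⊜ ((m ⊙ x) ⊙ i) ⊙ (j′ ⊙ d))
                 ≋-refl M′ I J′ (mono 1# t) (1-q^ (suc j)) ⟩
      M′ ⊛ mono 1# t ⊛ I ⊛ (J′ ⊛ 1-q^ (suc j))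
        ≈⟨ ⊛-cong (⊛-cong M′·q^t (≋-refl {I})) (inv-qfac-suc j) ⟩
      mono c (suc (t ℕ.+ j)) ⊛ M ⊛ I ⊛ J
        ≈⟨ solve 4 (λ x m i j → ((x ⊙ m) ⊙ i) ⊙ j ⊜ x ⊙ ((m ⊙ i) ⊙ j))
                 ≋-refl (mono c (suc (t ℕ.+ j))) M I J ⟩
      mono c (suc (t ℕ.+ j)) ⊛ binomialTerm t j ∎
      where
      open ≋-Reasoning
      M M′ I J J′ : Ser
      M = mono (pow a t * pow c j) (tri j)
      M′ = mono (pow a t * pow c (suc j)) (tri (suc j))
      I = inv (qfac t)
      J = inv (qfac j)
      J′ = inv (qfac (suc j))
      exponent : ∀ T t j → T ℕ.+ suc j ℕ.+ t ≡ suc (t ℕ.+ j) ℕ.+ T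
      exponent = solve-∀
      M′·q^t : M′ ⊛ mono 1# t ≋ mono c (suc (t ℕ.+ j)) ⊛ M
      M′·q^t = ≋-trans (mono⊛mono _ 1# (tri (suc j)) t) (≋-trans
        (mono-congˡ (tri (suc j) ℕ.+ t) (trans (*-identityʳ _) (trans (sym (*-assoc _ _ _)) (*-comm _ _))))
        (≋-trans (≋-reflexive (≡.cong (mono _) (exponent (tri j) t j)))
                 (≋-sym (mono⊛mono c _ (suc (t ℕ.+ j)) (tri j)))))

    -- In the j-th summand of binomialSum (i+1) split 1 - q^(i+1) = (1 - q^t) + q^t (1 - q^j), t + j = i + 1.
    binomialSum-rec-a : ∀ i → sumSer (suc (suc i)) (λ j → binomialTerm (suc i ∸ j) j ⊛ 1-q^ (suc i ∸ j))
                              ≋ mono a 0 ⊛ binomialSum i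
    binomialSum-rec-a i n = begin
      sumTo (suc i) f + f (suc i)
        ≈⟨ +-cong (sumTo-cong (suc i) shift) top ⟩
      sumTo (suc i) (λ j → (mono a 0 ⊛ binomialTerm (i ∸ j) j) n) + 0#
        ≈⟨ +-identityʳ _ ⟩
      sumTo (suc i) (λ j → (mono a 0 ⊛ binomialTerm (i ∸ j) j) n)
        ≈⟨ ⊛-sumSer (mono a 0) (suc i) (λ j → binomialTerm (i ∸ j) j) n ⟨
      (mono a 0 ⊛ binomialSum i) n ∎
      where
      open ≈-Reasoning
      f : ℕ → Carrier
      f j = (binomialTerm (suc i ∸ j) j ⊛ 1-q^ (suc i ∸ j)) n
      top : f (suc i) ≈ 0#
      top rewrite ℕₚ.n∸n≡0 i = ⊛-1-q^0 (binomialTerm 0 (suc i)) n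
      shift : ∀ j → j ℕ.< suc i → f j ≈ (mono a 0 ⊛ binomialTerm (i ∸ j) j) n
      shift j j≤i rewrite ℕₚ.+-∸-assoc 1 (ℕₚ.≤-pred j≤i) = binomialTerm-sucˡ (i ∸ j) j n

    binomialSum-rec-c : ∀ i → sumSer (suc (suc i)) (λ j → binomialTerm (suc i ∸ j) j ⊛ (mono 1# (suc i ∸ j) ⊛ 1-q^ j))
                              ≋ mono c (suc i) ⊛ binomialSum i
    binomialSum-rec-c i n = begin
      sumTo (suc (suc i)) g
        ≈⟨ sumTo-sucˡ (suc i) g ⟩
      g 0 + sumTo (suc i) (λ j → g (suc j))
        ≈⟨ +-cong bottom (sumTo-cong (suc i) shift) ⟩
      0# + sumTo (suc i) (λ j → (mono c (suc i) ⊛ binomialTerm (i ∸ j) j) n)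
        ≈⟨ +-identityˡ _ ⟩
      sumTo (suc i) (λ j → (mono c (suc i) ⊛ binomialTerm (i ∸ j) j) n)
        ≈⟨ ⊛-sumSer (mono c (suc i)) (suc i) (λ j → binomialTerm (i ∸ j) j) n ⟨
      (mono c (suc i) ⊛ binomialSum i) n ∎
      where
      open ≈-Reasoning
      g : ℕ → Carrier
      g j = (binomialTerm (suc i ∸ j) j ⊛ (mono 1# (suc i ∸ j) ⊛ 1-q^ j)) n
      bottom : g 0 ≈ 0#
      bottom = trans (sym (⊛-assoc (binomialTerm (suc i) 0) (mono 1# (suc i)) (1-q^ 0) n))
                     (⊛-1-q^0 _ n)
      shift : ∀ j → j ℕ.< suc i → g (suc j) ≈ (mono c (suc i) ⊛ binomialTerm (i ∸ j) j) n
      shift j j≤i = trans (binomialTerm-sucʳ (i ∸ j) j n)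
        (⊛-cong (≋-reflexive (≡.cong (λ m → mono c (suc m)) (ℕₚ.m∸n+n≡m (ℕₚ.≤-pred j≤i))))
                (≋-refl {binomialTerm (i ∸ j) j}) n)

    binomialSum-rec : ∀ i → binomialSum (suc i) ⊛ 1-q^ (suc i) ≋ binomialSum i ⊛ acFactor i
    binomialSum-rec i = begin
      binomialSum (suc i) ⊛ 1-q^ (suc i)
        ≈⟨ sumSer-⊛ (1-q^ (suc i)) (suc (suc i)) _ ⟩
      sumSer (suc (suc i)) (λ j → T j ⊛ 1-q^ (suc i))
        ≈⟨ sumSer-cong (suc (suc i)) split ⟩
      sumSer (suc (suc i)) (λ j → T j ⊛ 1-q^ (suc i ∸ j) ⊕ T j ⊛ (mono 1# (suc i ∸ j) ⊛ 1-q^ j))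
        ≈⟨ sumSer-distrib-⊕ (suc (suc i)) ⟩
      sumSer (suc (suc i)) (λ j → T j ⊛ 1-q^ (suc i ∸ j))
        ⊕ sumSer (suc (suc i)) (λ j → T j ⊛ (mono 1# (suc i ∸ j) ⊛ 1-q^ j))
        ≈⟨ ⊕-cong (binomialSum-rec-a i) (binomialSum-rec-c i) ⟩
      mono a 0 ⊛ binomialSum i ⊕ mono c (suc i) ⊛ binomialSum i
        ≈⟨ ⊛-distribʳ (binomialSum i) (mono a 0) (mono c (suc i)) ⟨
      acFactor i ⊛ binomialSum i
        ≈⟨ ⊛-comm (acFactor i) (binomialSum i) ⟩
      binomialSum i ⊛ acFactor i ∎
      where
      open ≋-Reasoning
      T : ℕ → Ser
      T j = binomialTerm (suc i ∸ j) j
      split : ∀ j → j ℕ.< suc (suc i) →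
              T j ⊛ 1-q^ (suc i) ≋ T j ⊛ 1-q^ (suc i ∸ j) ⊕ T j ⊛ (mono 1# (suc i ∸ j) ⊛ 1-q^ j)
      split j j≤1+i = ≋-trans
        (⊛-cong (≋-refl {T j})
          (≋-trans (≋-reflexive (≡.cong 1-q^_ (≡.sym (ℕₚ.m∸n+n≡m (ℕₚ.≤-pred j≤1+i)))))
                   (1-q^-+ (suc i ∸ j) j)))
        (⊛-distribˡ (T j) (1-q^ (suc i ∸ j)) (mono 1# (suc i ∸ j) ⊛ 1-q^ j))

    acRatio-rec : ∀ i → acRatio (suc i) ⊛ 1-q^ (suc i) ≋ acRatio i ⊛ acFactor i
    acRatio-rec i = begin
      P ⊛ acFactor i ⊛ I′ ⊛ 1-q^ (suc i)
        ≈⟨ ⊛-assoc (P ⊛ acFactor i) I′ (1-q^ (suc i)) ⟩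
      P ⊛ acFactor i ⊛ (I′ ⊛ 1-q^ (suc i))
        ≈⟨ ⊛-cong (≋-refl {P ⊛ acFactor i}) (inv-qfac-suc i) ⟩
      P ⊛ acFactor i ⊛ I
        ≈⟨ solve 3 (λ p x i → (p ⊙ x) ⊙ i ⊜ (p ⊙ i) ⊙ x) ≋-refl P (acFactor i) I ⟩
      P ⊛ I ⊛ acFactor i ∎
      where
      open ≋-Reasoning
      P I I′ : Ser
      P = acPoch a c i
      I = inv (qfac i)
      I′ = inv (qfac (suc i))

    q-binomial : ∀ i → acRatio i ≋ binomialSum i
    q-binomial zero    = ≋-trans (≋-trans (⊛-identityˡ (inv one)) inv-one) (≋-sym binomialSum-zero)
      where
      binomialSum-zero : binomialSum 0 ≋ one
      binomialSum-zero n = trans (+-identityˡ _) (≋-trans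
        (⊛-cong (⊛-cong (mono-congˡ 0 (*-identityˡ 1#)) inv-one) inv-one)
        (≋-trans (⊛-identityʳ (one ⊛ one)) (⊛-identityʳ one)) n)
    q-binomial (suc i) = ⊛-cancelʳ (1-q^ (suc i)) (+-identityʳ 1#) (begin
      acRatio (suc i) ⊛ 1-q^ (suc i)       ≈⟨ acRatio-rec i ⟩
      acRatio i ⊛ acFactor i               ≈⟨ ⊛-cong (q-binomial i) (≋-refl {acFactor i}) ⟩
      binomialSum i ⊛ acFactor i           ≈⟨ binomialSum-rec i ⟨
      binomialSum (suc i) ⊛ 1-q^ (suc i)   ∎)
      where open ≋-Reasoning

  -- Euler's expansion of (-b q^(i+1); q)_∞

  module Euler (b : Carrier) where

    eulerTerm : ℕ → ℕ → Ser
    eulerTerm i l = mono (pow b l) (tri l ℕ.+ i ℕ.* l) ⊛ inv (qfac l)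

    eulerSum : ℕ → Ser
    eulerSum i = sum∞ (eulerTerm i)

    eulerTerm-order : ∀ i l → Order≥ (eulerTerm i l) (tri l ℕ.+ i ℕ.* l)
    eulerTerm-order i l = order-⊛ˡ (inv (qfac l)) (order-mono (pow b l) (tri l ℕ.+ i ℕ.* l))

    eulerTerm-summable : ∀ i → Summable (eulerTerm i)
    eulerTerm-summable i l =
      order-≤ (ℕₚ.≤-trans (n≤tri l) (ℕₚ.m≤m+n (tri l) (i ℕ.* l))) (eulerTerm-order i l)

    eulerTerm-zero : ∀ i → eulerTerm i 0 ≋ one
    eulerTerm-zero i =
      ≋-trans (⊛-cong (≋-reflexive (≡.cong (mono 1#) (ℕₚ.*-zeroʳ i))) inv-one) (⊛-identityʳ one)

    eulerSum-low : ∀ i n → n ℕ.< suc i → eulerSum i n ≈ one n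
    eulerSum-low i n n≤i = trans (sumTo-sucˡ n (λ l → eulerTerm i l n))
      (trans (+-cong (eulerTerm-zero i n)
                     (sumTo-zero n (λ l _ → eulerTerm-order i (suc l) n (ℕₚ.<-≤-trans n≤i (1+i≤ l)))))
             (+-identityʳ _))
      where
      1+i≤ : ∀ l → suc i ℕ.≤ tri (suc l) ℕ.+ i ℕ.* suc l
      1+i≤ l rewrite ℕₚ.*-suc i l =
        ℕₚ.+-mono-≤ {1} {tri l ℕ.+ suc l} (ℕₚ.≤-trans (s≤s z≤n) (ℕₚ.m≤n+m (suc l) (tri l)))
                    (ℕₚ.m≤m+n i (i ℕ.* l))

    -- Multiply the (l+1)-st term by 1 = q^(l+1) + (1 - q^(l+1)).
    eulerTerm-split : ∀ i l → eulerTerm i (suc l) ≋ eulerTerm (suc i) (suc l) ⊕ mono b (suc i) ⊛ eulerTerm (suc i) l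
    eulerTerm-split i l = begin
      eulerTerm i (suc l)
        ≈⟨ ⊛-identityʳ _ ⟨
      X ⊛ I′ ⊛ one
        ≈⟨ ⊛-cong (≋-refl {X ⊛ I′}) (q^⊕1-q^ (suc l)) ⟨
      X ⊛ I′ ⊛ (mono 1# (suc l) ⊕ 1-q^ (suc l))
        ≈⟨ ⊛-distribˡ (X ⊛ I′) (mono 1# (suc l)) (1-q^ (suc l)) ⟩
      X ⊛ I′ ⊛ mono 1# (suc l) ⊕ X ⊛ I′ ⊛ 1-q^ (suc l)
        ≈⟨ ⊕-cong first second ⟩
      eulerTerm (suc i) (suc l) ⊕ mono b (suc i) ⊛ eulerTerm (suc i) l ∎
      where
      open ≋-Reasoning
      e : ℕ
      e = tri (suc l) ℕ.+ i ℕ.* suc l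
      X I′ : Ser
      X = mono (pow b (suc l)) e
      I′ = inv (qfac (suc l))
      exponent₁ : ∀ T l i → T ℕ.+ suc l ℕ.+ i ℕ.* suc l ℕ.+ suc l ≡ T ℕ.+ suc l ℕ.+ suc i ℕ.* suc l
      exponent₁ = solve-∀
      exponent₂ : ∀ T l i → suc i ℕ.+ (T ℕ.+ suc i ℕ.* l) ≡ T ℕ.+ suc l ℕ.+ i ℕ.* suc l
      exponent₂ = solve-∀
      first : X ⊛ I′ ⊛ mono 1# (suc l) ≋ eulerTerm (suc i) (suc l)
      first = ≋-trans (solve 3 (λ x i′ y → (x ⊙ i′) ⊙ y ⊜ (x ⊙ y) ⊙ i′) ≋-refl X I′ (mono 1# (suc l)))
        (⊛-cong (≋-trans (mono⊛mono _ 1# e (suc l))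
                 (≋-trans (mono-congˡ (e ℕ.+ suc l) (*-identityʳ _))
                          (≋-reflexive (≡.cong (mono _) (exponent₁ (tri l) l i)))))
                (≋-refl {I′}))
      second : X ⊛ I′ ⊛ 1-q^ (suc l) ≋ mono b (suc i) ⊛ eulerTerm (suc i) l
      second = begin
        X ⊛ I′ ⊛ 1-q^ (suc l)                ≈⟨ ⊛-assoc X I′ (1-q^ (suc l)) ⟩
        X ⊛ (I′ ⊛ 1-q^ (suc l))              ≈⟨ ⊛-cong (≋-sym b·M) (inv-qfac-suc l) ⟩
        mono b (suc i) ⊛ M ⊛ inv (qfac l)    ≈⟨ ⊛-assoc (mono b (suc i)) M (inv (qfac l)) ⟩
        mono b (suc i) ⊛ eulerTerm (suc i) l ∎
        where
        M : Ser
        M = mono (pow b l) (tri l ℕ.+ suc i ℕ.* l)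
        b·M : mono b (suc i) ⊛ M ≋ X
        b·M = ≋-trans (mono⊛mono b (pow b l) (suc i) (tri l ℕ.+ suc i ℕ.* l))
          (≋-trans (mono-congˡ (suc i ℕ.+ (tri l ℕ.+ suc i ℕ.* l)) (*-comm b (pow b l)))
                   (≋-reflexive (≡.cong (mono _) (exponent₂ (tri l) l i))))

    eulerSum-unfold : ∀ i → eulerSum i ≋ (one ⊕ mono b (suc i)) ⊛ eulerSum (suc i)
    eulerSum-unfold i n = begin
      sumTo (suc n) (λ l → eulerTerm i l n)
        ≈⟨ sumTo-sucˡ n _ ⟩
      eulerTerm i 0 n + sumTo n (λ l → eulerTerm i (suc l) n)
        ≈⟨ +-cong refl (trans (sumTo-cong′ n (λ l → eulerTerm-split i l n)) (sumTo-distrib-+ n)) ⟩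
      eulerTerm (suc i) 0 n + (sumTo n (λ l → eulerTerm (suc i) (suc l) n) + sumTo n bE)
        ≈⟨ +-assoc _ _ _ ⟨
      (eulerTerm (suc i) 0 n + sumTo n (λ l → eulerTerm (suc i) (suc l) n)) + sumTo n bE
        ≈⟨ +-cong (sumTo-sucˡ n _) (sumTo-extend (suc n) (ℕₚ.n≤1+n n) bE≈0) ⟨
      eulerSum (suc i) n + sumTo (suc n) bE
        ≈⟨ +-cong refl (⊛-sum∞ (mono b (suc i)) (eulerTerm-summable (suc i)) n) ⟨
      eulerSum (suc i) n + (mono b (suc i) ⊛ eulerSum (suc i)) n
        ≈⟨ one⊕mono-⊛ (eulerSum (suc i)) b (suc i) n ⟨
      ((one ⊕ mono b (suc i)) ⊛ eulerSum (suc i)) n ∎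
      where
      open ≈-Reasoning
      bE : ℕ → Carrier
      bE l = (mono b (suc i) ⊛ eulerTerm (suc i) l) n
      bE≈0 : ∀ l → n ℕ.≤ l → bE l ≈ 0#
      bE≈0 l n≤l = order-mono⊛ b (suc i) {eulerTerm (suc i) l} (eulerTerm-summable (suc i) l) n
                      (s≤s (ℕₚ.≤-trans n≤l (ℕₚ.m≤n+m l i)))

    euler : ∀ i → pochInf (- b) (suc i) ≋ eulerSum i
    euler = recurrence-unique (λ i → one ⊕ mono b (suc i)) pochInf-unfold′ eulerSum-unfold low
      where
      pochInf-unfold′ : ∀ i → pochInf (- b) (suc i) ≋ (one ⊕ mono b (suc i)) ⊛ pochInf (- b) (suc (suc i))
      pochInf-unfold′ i = ≋-trans (pochInf-unfold (- b) i)
        (⊛-cong (⊕-cong ≋-refl (mono-congˡ (suc i) (-‿involutive b))) (≋-refl {pochInf (- b) (suc (suc i))}))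
      low : ∀ i n → n ℕ.< suc i → pochInf (- b) (suc i) n ≈ eulerSum i n
      low i n n≤i = trans (pochInf-low (- b) i n n≤i) (sym (eulerSum-low i n n≤i))

  module Expansion (a b c : Carrier) where
    open QBinomial a c
    open Euler b

    rhsTerm-factorisation : ∀ t l j → mono 1# (tri (t ℕ.+ j)) ⊛ binomialTerm t j ⊛ eulerTerm (t ℕ.+ j) l
                                      ≋ rhsTerm a b c t l j
    rhsTerm-factorisation t l j = begin
      m₁ ⊛ (m₂ ⊛ I ⊛ J) ⊛ (m₃ ⊛ L)
        ≈⟨ solve 6 (λ x y i j z l → (x ⊙ ((y ⊙ i) ⊙ j)) ⊙ (z ⊙ l) ⊜ ((((x ⊙ y) ⊙ z) ⊙ i) ⊙ l) ⊙ j)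
                 ≋-refl m₁ m₂ I J m₃ L ⟩
      m₁ ⊛ m₂ ⊛ m₃ ⊛ I ⊛ L ⊛ J
        ≈⟨ ⊛-cong (⊛-cong (⊛-cong monomial (≋-refl {I})) (≋-refl {L})) (≋-refl {J}) ⟩
      rhsTerm a b c t l j ∎
      where
      open ≋-Reasoning
      m₁ m₂ m₃ I J L : Ser
      m₁ = mono 1# (tri (t ℕ.+ j))
      m₂ = mono (pow a t * pow c j) (tri j)
      m₃ = mono (pow b l) (tri l ℕ.+ (t ℕ.+ j) ℕ.* l)
      I = inv (qfac t)
      J = inv (qfac j)
      L = inv (qfac l)
      coefficient : 1# * (pow a t * pow c j) * pow b l ≈ pow a t * pow b l * pow c j
      coefficient = trans (*-cong (*-identityˡ _) refl)
        (trans (*-assoc _ _ _) (trans (*-cong refl (*-comm _ _)) (sym (*-assoc _ _ _))))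
      monomial : m₁ ⊛ m₂ ⊛ m₃ ≋ mono (pow a t * pow b l * pow c j) (tri (t ℕ.+ l ℕ.+ j) ℕ.+ tri j)
      monomial = ≋-trans (⊛-cong (mono⊛mono 1# _ (tri (t ℕ.+ j)) (tri j)) (≋-refl {m₃}))
        (≋-trans (mono⊛mono (1# * (pow a t * pow c j)) (pow b l) (tri (t ℕ.+ j) ℕ.+ tri j) (tri l ℕ.+ (t ℕ.+ j) ℕ.* l))
        (≋-trans (mono-congˡ (tri (t ℕ.+ j) ℕ.+ tri j ℕ.+ (tri l ℕ.+ (t ℕ.+ j) ℕ.* l)) coefficient)
                 (≋-reflexive (≡.cong (mono _) (exponent-merge t l j)))))

    lhsTerm-expansion : ∀ i → lhsTerm a b c i ≋ sumSer (suc i) (λ j → sum∞ (λ l → rhsTerm a b c (i ∸ j) l j))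
    lhsTerm-expansion i = begin
      m ⊛ inv (qfac i) ⊛ acPoch a c i ⊛ pochInf (- b) (suc i)
        ≈⟨ solve 4 (λ x y z w → ((x ⊙ y) ⊙ z) ⊙ w ⊜ (x ⊙ (z ⊙ y)) ⊙ w)
                 ≋-refl m (inv (qfac i)) (acPoch a c i) (pochInf (- b) (suc i)) ⟩
      m ⊛ acRatio i ⊛ pochInf (- b) (suc i)
        ≈⟨ ⊛-cong (⊛-cong (≋-refl {m}) (q-binomial i)) (euler i) ⟩
      m ⊛ binomialSum i ⊛ eulerSum i
        ≈⟨ ⊛-cong (⊛-sumSer m (suc i) (λ j → binomialTerm (i ∸ j) j)) (≋-refl {eulerSum i}) ⟩
      sumSer (suc i) (λ j → m ⊛ binomialTerm (i ∸ j) j) ⊛ eulerSum i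
        ≈⟨ sumSer-⊛ (eulerSum i) (suc i) (λ j → m ⊛ binomialTerm (i ∸ j) j) ⟩
      sumSer (suc i) (λ j → m ⊛ binomialTerm (i ∸ j) j ⊛ eulerSum i)
        ≈⟨ sumSer-cong (suc i) (λ j j≤i → ≋-trans (⊛-sum∞ _ (eulerTerm-summable i))
                                                 (sum∞-cong (λ l → factorisation j l j≤i))) ⟩
      sumSer (suc i) (λ j → sum∞ (λ l → rhsTerm a b c (i ∸ j) l j)) ∎
      where
      open ≋-Reasoning
      m : Ser
      m = mono 1# (tri i)
      factorisation : ∀ j l → j ℕ.< suc i →
                      m ⊛ binomialTerm (i ∸ j) j ⊛ eulerTerm i l ≋ rhsTerm a b c (i ∸ j) l j
      factorisation j l j≤i =
        ≡.subst (λ k → mono 1# (tri k) ⊛ binomialTerm (i ∸ j) j ⊛ eulerTerm k l ≋ rhsTerm a b c (i ∸ j) l j)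
                (ℕₚ.m∸n+n≡m (ℕₚ.≤-pred j≤i)) (rhsTerm-factorisation (i ∸ j) l j)

    rhsTerm-order : ∀ t l j → Order≥ (rhsTerm a b c t l j) (t ℕ.+ j)
    rhsTerm-order t l j =
      order-⊛ˡ (inv (qfac j)) (order-⊛ˡ (inv (qfac l)) (order-⊛ˡ (inv (qfac t)) (order-≤ t+j≤ (order-mono _ _))))
      where
      t+j≤ : t ℕ.+ j ℕ.≤ tri (t ℕ.+ l ℕ.+ j) ℕ.+ tri j
      t+j≤ = ℕₚ.≤-trans (ℕₚ.+-monoˡ-≤ j (ℕₚ.m≤m+n t l))
               (ℕₚ.≤-trans (n≤tri (t ℕ.+ l ℕ.+ j)) (ℕₚ.m≤m+n _ (tri j)))

theorem4p1 : ∀ {ℓ₁ ℓ₂} (R : CommutativeRing ℓ₁ ℓ₂)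
               (a b c : CommutativeRing.Carrier R) (n : ℕ) →
               CommutativeRing._≈_ R (Series.LHS R a b c n) (Series.RHS R a b c n)
theorem4p1 R a b c n = begin
  Series.LHS R a b c n
    ≈⟨ sumTo-cong′ (suc n) (λ i → lhsTerm-expansion i n) ⟩
  sumTo (suc n) (λ i → sumTo (suc i) (λ j → F (i ∸ j) j))
    ≈⟨ sumTo-antidiagonal (suc n) F (λ t j n<t+j → sumTo-zero (suc n) (λ l _ → rhsTerm-order t l j n n<t+j)) ⟩
  sumTo (suc n) (λ t → sumTo (suc n) (λ j → F t j))
    ≈⟨ sumTo-cong′ (suc n) (λ t → sumTo-swap (suc n) (suc n) (λ j l → rhsTerm a b c t l j n)) ⟩
  Series.RHS R a b c n ∎
  where
  open CommutativeRing R using (Carrier)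
  open Series R using (sumTo; rhsTerm)
  open PowerSeries R
  open Expansion a b c
  open ≈-Reasoning
  F : ℕ → ℕ → Carrier
  F t j = sum∞ (λ l → rhsTerm a b c t l j) n
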